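{- Suppose every term of $\lambda^{Sym}_{Prop}$ is strongly normalizing with respect to $\to_{\beta\pi}$. Then every term of $\lambda^{Sym}_{Prop}$ is strongly normalizing with respect to $\to_{\beta\pi\eta}$.
   Context: The calculus $\lambda^{Sym}_{Prop}$: m-types $A::=\alpha\mid\alpha^\bot\mid A\wedge A\mid A\vee A$; types $C::=A\mid\bot$; negation $(\alpha)^\bot=\alpha^\bot$, $(\alpha^\bot)^\bot=\alpha$, $(A\wedge B)^\bot=A^\bot\vee B^\bot$, $(A\vee B)^\bot=A^\bot\wedge B^\bot$. Typed terms: variables; $\langle P_1,P_2\rangle:A_1\wedge A_2$; $\sigma_i(P_i):A_1\vee A_2$; $\lambda xP:A^\bot$ (from $x:A\vdash P:\bot$); $(P_1\star P_2):\bot$ ($P_1:A^\bot$, $P_2:A$); terms are the typable ones. $\to_{\beta\pi}$ is the compatible closure of ($\beta$) $(\lambda xP\star Q)\to P[x:=Q]$, ($\beta^\bot$) $(Q\star\lambda xP)\to P[x:=Q]$, ($\pi$) $(\langle P_1,P_2\rangle\star\sigma_i(Q))\to(P_i\star Q)$, ($\pi^\bot$) $(\sigma_i(Q)\star\langle P_1,P_2\rangle)\to(Q\star P_i)$. $\to_{\beta\pi\eta}$ is the compatible closure of these four rules together with ($\eta$) $\lambda x(P\star x)\to P$ and ($\eta^\bot$) $\lambda x(x\star P)\to P$, both when $x\notin Fv(P)$. -}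

module Defs where

open import Data.Nat using (ℕ)
open import Data.List using (List; _∷_; [])
open import Data.Sum using (_⊎_)
open import Relation.Binary.PropositionalEquality using (_≡_; refl; sym; cong₂; subst)
open import Induction.WellFounded using (Acc)

infixr 6 _∧_
infixr 5 _∨_

data MType : Set where
  atom  : ℕ → MType
  natom : ℕ → MType
  _∧_   : MType → MType → MType
  _∨_   : MType → MType → MType

data Type : Set where
  m   : MType → Type
  bot : Type

neg : MType → MType
neg (atom a)  = natom a
neg (natom a) = atom a
neg (A ∧ B)   = neg A ∨ neg B
neg (A ∨ B)   = neg A ∧ neg B

neg-invol : ∀ A → neg (neg A) ≡ A
neg-invol (atom a)  = refl
neg-invol (natom a) = refl
neg-invol (A ∧ B)   = cong₂ _∧_ (neg-invol A) (neg-invol B)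
neg-invol (A ∨ B)   = cong₂ _∨_ (neg-invol A) (neg-invol B)

-- contexts (variables are bound by λ, hence carry m-types); de Bruijn variables
Ctx : Set
Ctx = List MType

data _∋_ : Ctx → MType → Set where
  here  : ∀ {Γ A} → (A ∷ Γ) ∋ A
  there : ∀ {Γ A B} → Γ ∋ A → (B ∷ Γ) ∋ A

data Tm (Γ : Ctx) : Type → Set where
  var  : ∀ {A} → Γ ∋ A → Tm Γ (m A)
  pair : ∀ {A B} → Tm Γ (m A) → Tm Γ (m B) → Tm Γ (m (A ∧ B))
  σ₁   : ∀ {A B} → Tm Γ (m A) → Tm Γ (m (A ∨ B))
  σ₂   : ∀ {A B} → Tm Γ (m B) → Tm Γ (m (A ∨ B))
  lam  : ∀ {A} → Tm (A ∷ Γ) bot → Tm Γ (m (neg A))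
  _⋆_  : ∀ {A} → Tm Γ (m (neg A)) → Tm Γ (m A) → Tm Γ bot

Ren : Ctx → Ctx → Set
Ren Γ Δ = ∀ {A} → Γ ∋ A → Δ ∋ A

ext : ∀ {Γ Δ B} → Ren Γ Δ → Ren (B ∷ Γ) (B ∷ Δ)
ext ρ here      = here
ext ρ (there x) = there (ρ x)

rename : ∀ {Γ Δ C} → Ren Γ Δ → Tm Γ C → Tm Δ C
rename ρ (var x)    = var (ρ x)
rename ρ (pair P Q) = pair (rename ρ P) (rename ρ Q)
rename ρ (σ₁ P)     = σ₁ (rename ρ P)
rename ρ (σ₂ P)     = σ₂ (rename ρ P)
rename ρ (lam P)    = lam (rename (ext ρ) P)
rename ρ (P ⋆ Q)    = rename ρ P ⋆ rename ρ Q

weaken : ∀ {Γ B C} → Tm Γ C → Tm (B ∷ Γ) C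
weaken = rename there

Sub : Ctx → Ctx → Set
Sub Γ Δ = ∀ {A} → Γ ∋ A → Tm Δ (m A)

exts : ∀ {Γ Δ B} → Sub Γ Δ → Sub (B ∷ Γ) (B ∷ Δ)
exts σ here      = var here
exts σ (there x) = weaken (σ x)

subst-tm : ∀ {Γ Δ C} → Sub Γ Δ → Tm Γ C → Tm Δ C
subst-tm σ (var x)    = σ x
subst-tm σ (pair P Q) = pair (subst-tm σ P) (subst-tm σ Q)
subst-tm σ (σ₁ P)     = σ₁ (subst-tm σ P)
subst-tm σ (σ₂ P)     = σ₂ (subst-tm σ P)
subst-tm σ (lam P)    = lam (subst-tm (exts σ) P)
subst-tm σ (P ⋆ Q)    = subst-tm σ P ⋆ subst-tm σ Q

single : ∀ {Γ A} → Tm Γ (m A) → Sub (A ∷ Γ) Γ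
single Q here      = Q
single Q (there x) = var x

_[_] : ∀ {Γ A C} → Tm (A ∷ Γ) C → Tm Γ (m A) → Tm Γ C
P [ Q ] = subst-tm (single Q) P

cast¬¬ : ∀ {Γ} A → Tm Γ (m A) → Tm Γ (m (neg (neg A)))
cast¬¬ {Γ} A P = subst (λ B → Tm Γ (m B)) (sym (neg-invol A)) P

Rel : Set₁
Rel = ∀ {Γ C} → Tm Γ C → Tm Γ C → Set

data βπ-root : Rel where
  β   : ∀ {Γ A} (P : Tm (A ∷ Γ) bot) (Q : Tm Γ (m A)) →
        βπ-root (lam P ⋆ Q) (P [ Q ])
  β⊥  : ∀ {Γ A} (P : Tm (A ∷ Γ) bot) (Q : Tm Γ (m A)) →
        βπ-root (cast¬¬ A Q ⋆ lam P) (P [ Q ])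
  π₁  : ∀ {Γ A B} (P₁ : Tm Γ (m (neg A))) (P₂ : Tm Γ (m (neg B))) (Q : Tm Γ (m A)) →
        βπ-root (_⋆_ {A = A ∨ B} (pair P₁ P₂) (σ₁ Q)) (P₁ ⋆ Q)
  π₂  : ∀ {Γ A B} (P₁ : Tm Γ (m (neg A))) (P₂ : Tm Γ (m (neg B))) (Q : Tm Γ (m B)) →
        βπ-root (_⋆_ {A = A ∨ B} (pair P₁ P₂) (σ₂ Q)) (P₂ ⋆ Q)
  π⊥₁ : ∀ {Γ A B} (Q : Tm Γ (m (neg A))) (P₁ : Tm Γ (m A)) (P₂ : Tm Γ (m B)) →
        βπ-root (_⋆_ {A = A ∧ B} (σ₁ Q) (pair P₁ P₂)) (Q ⋆ P₁)
  π⊥₂ : ∀ {Γ A B} (Q : Tm Γ (m (neg B))) (P₁ : Tm Γ (m A)) (P₂ : Tm Γ (m B)) →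
        βπ-root (_⋆_ {A = A ∧ B} (σ₂ Q) (pair P₁ P₂)) (Q ⋆ P₂)

-- root rules η, η^⊥ (x ∉ Fv(P) is expressed by P being a weakening)
data η-root : Rel where
  η  : ∀ {Γ A} (P : Tm Γ (m (neg A))) →
       η-root (lam {A = A} (weaken P ⋆ var here)) P
  η⊥ : ∀ {Γ A} (P : Tm Γ (m A)) →
       η-root (lam {A = neg A} (_⋆_ {A = A} (var here) (weaken P))) (cast¬¬ A P)

βπη-root : Rel
βπη-root t u = βπ-root t u ⊎ η-root t u

data Compat (R : Rel) : Rel where
  root  : ∀ {Γ C} {t u : Tm Γ C} → R t u → Compat R t u
  pairˡ : ∀ {Γ A B} {P P' : Tm Γ (m A)} {Q : Tm Γ (m B)} →
          Compat R P P' → Compat R (pair P Q) (pair P' Q)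
  pairʳ : ∀ {Γ A B} {P : Tm Γ (m A)} {Q Q' : Tm Γ (m B)} →
          Compat R Q Q' → Compat R (pair P Q) (pair P Q')
  σ₁-c  : ∀ {Γ A B} {P P' : Tm Γ (m A)} →
          Compat R P P' → Compat R (σ₁ {B = B} P) (σ₁ P')
  σ₂-c  : ∀ {Γ A B} {P P' : Tm Γ (m B)} →
          Compat R P P' → Compat R (σ₂ {A = A} P) (σ₂ P')
  lam-c : ∀ {Γ A} {P P' : Tm (A ∷ Γ) bot} →
          Compat R P P' → Compat R (lam P) (lam P')
  ⋆ˡ    : ∀ {Γ A} {P P' : Tm Γ (m (neg A))} {Q : Tm Γ (m A)} →
          Compat R P P' → Compat R (P ⋆ Q) (P' ⋆ Q)
  ⋆ʳ    : ∀ {Γ A} {P : Tm Γ (m (neg A))} {Q Q' : Tm Γ (m A)} →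
          Compat R Q Q' → Compat R (P ⋆ Q) (P ⋆ Q')

_→βπ_ : Rel
_→βπ_ = Compat βπ-root

_→βπη_ : Rel
_→βπη_ = Compat βπη-root

SN : Rel → ∀ {Γ C} → Tm Γ C → Set
SN R {Γ} {C} t = Acc (λ u v → R v u) t

module Submission where

-- η-steps can be postponed after βπ-steps, hence βπ-SN implies βπη-SN.
--
-- Abstractly (module Postponement): let ⟶ and ⇝ be relations
-- such that every ⇝-step followed by a ⟶-step can be replaced by a nonempty
-- ⟶-sequence followed by ⇝-steps.  If every step of a third relation ↝ is a
-- ⟶-step or a ⇝-step that decreases a size measure, then every ⟶-SN element is
-- ↝-SN: along a ↝-sequence we keep a ⟶-SN term t with t ⇝* s for the current
-- term s, and each step either lets t advance by ⟶⁺ or lowers the size of s.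
--
-- Concretely ⟶ is →βπ and ⇝ is the compatible closure of η, η^⊥ and of the
-- exchange of the two sides of a cut, P ⋆ Q ⇝ Q ⋆ P.  The exchange is needed
-- because the β-redex (λx(x ⋆ P)) ⋆ R contracts to R ⋆ P, whereas its η^⊥-reduct
-- is P ⋆ R.

open import Defs
open import Data.Nat using (ℕ; suc; _+_; _<_; s≤s)
open import Data.Nat.Properties using (+-monoˡ-<; +-monoʳ-<; m≤m+n; m≤n⇒m≤1+n; n<1+n)
open import Data.Nat.Induction using (<-wellFounded)
open import Data.List using (_∷_)
open import Data.Product using (∃-syntax; _×_; _,_)
open import Data.Sum as Sum using (_⊎_)
open import Function using (flip)
open import Induction.WellFounded using (Acc; acc; module Subrelation)
open import Relation.Binary.PropositionalEquality using (_≡_; refl; sym; trans; cong; cong₂; subst; subst₂)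
open import Relation.Binary.Construct.Closure.ReflexiveTransitive using (Star; ε; _◅_; _◅◅_; gmap)
open import Relation.Binary.Construct.Closure.Transitive as Plus
  using (TransClosure; _∷_; _∷ʳ_; _++_) renaming ([_] to [_]⁺)

module Postponement {X : Set} (_⟶_ _⇝_ : X → X → Set) where

  _⟶⁺_ : X → X → Set
  _⟶⁺_ = TransClosure _⟶_

  infix  4 _⟶⁺_ _⇝*_ _⟶⁺⇝*_
  infixr 5 _++*_

  -- ⇝-sequences, stored last step first, so that induction peels off the final step
  _⇝*_ : X → X → Set
  t ⇝* u = Star (flip _⇝_) u t

  step* : ∀ {t u} → t ⇝ u → t ⇝* u
  step* s = s ◅ ε

  _++*_ : ∀ {t u v} → t ⇝* u → u ⇝* v → t ⇝* v
  p ++* q = q ◅◅ p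

  _⟶⁺⇝*_ : X → X → Set
  t ⟶⁺⇝* v = ∃[ w ] (t ⟶⁺ w × w ⇝* v)

  LocallyPostponable : Set
  LocallyPostponable = ∀ {t u v} → t ⇝ u → u ⟶ v → t ⟶⁺⇝* v

  SN⁺ : X → Set
  SN⁺ = Acc (flip _⟶⁺_)

  -- ⟶-SN implies ⟶⁺-SN (the library proves this for TransClosure of the
  -- converse relation, so nonempty sequences are reversed first)
  sn⁺ : ∀ {t} → Acc (flip _⟶_) t → SN⁺ t
  sn⁺ a = Subrelation.accessible reverse (Plus.accessible (flip _⟶_) a)
    where
      reverse : ∀ {x y} → x ⟶⁺ y → TransClosure (flip _⟶_) y x
      reverse [ s ]⁺   = [ s ]⁺
      reverse (s ∷ p) = reverse p ∷ʳ s

  module _ (postpone : LocallyPostponable) where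

    -- local postponement extends to t ⇝* u ⟶⁺ z; the sequence t ⟶⁺ ... grows
    -- while the ⇝-prefix is processed, so the induction is on SN⁺ t
    postpone⁺ : ∀ {t u z} → SN⁺ t → t ⇝* u → u ⟶⁺ z → t ⟶⁺⇝* z
    postpone⁺ a ε p = _ , p , ε
    postpone⁺ a (s ◅ xs) [ st ]⁺ =
      let (b , p , q) = postpone s st
          (w , p′ , q′) = postpone⁺ a xs p
      in w , p′ , q′ ++* q
    postpone⁺ (acc rs) (s ◅ xs) (st ∷ rest) =
      let (b , p , q) = postpone s st
          (w , p′ , q′) = postpone⁺ (acc rs) xs p
          (w₂ , p₂ , q₂) = postpone⁺ (rs p′) (q′ ++* q) rest
      in w₂ , p′ ++ p₂ , q₂

    -- the abstract theorem: if each ↝-step is a ⟶-step or a size-decreasing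
    -- ⇝-step, then ⟶-SN implies ↝-SN (lexicographic induction on SN⁺ t and on
    -- the size of the current term s, with invariant t ⇝* s)
    sn-by-postponement :
      (_↝_ : X → X → Set) (size : X → ℕ) →
      (∀ {t u} → t ↝ u → t ⟶ u ⊎ (t ⇝ u × size u < size t)) →
      ∀ {t} → Acc (flip _⟶_) t → Acc (flip _↝_) t
    sn-by-postponement _↝_ size split a = go (sn⁺ a) ε (<-wellFounded _)
      where
        go : ∀ {t s} → SN⁺ t → t ⇝* s → Acc _<_ (size s) → Acc (flip _↝_) s
        go (acc rs) xs (acc rsz) = acc λ st → Sum.[
            (λ main → let (w , p , q) = postpone⁺ (acc rs) xs [ main ]⁺
                      in go (rs p) q (<-wellFounded _)) ,
            (λ (aux , smaller) → go (acc rs) (aux ◅ xs) (rsz smaller)) ]′ (split st)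

cast : ∀ {Γ A B} → A ≡ B → Tm Γ (m A) → Tm Γ (m B)
cast {Γ} e t = subst (λ B → Tm Γ (m B)) e t

cast-irrelevant : ∀ {Γ A B} (e e′ : A ≡ B) (t : Tm Γ (m A)) → cast e t ≡ cast e′ t
cast-irrelevant refl refl t = refl

cast-cancel : ∀ {Γ A B} (e : A ≡ B) (e′ : B ≡ A) (t : Tm Γ (m A)) → cast e′ (cast e t) ≡ t
cast-cancel refl refl t = refl

cut-cast : ∀ {Γ A A′} (e : A ≡ A′) (P : Tm Γ (m (neg A))) (Q : Tm Γ (m A)) →
           P ⋆ Q ≡ cast (cong neg e) P ⋆ cast e Q
cut-cast refl P Q = refl

cast-σ₁ : ∀ {Γ A B A′ B′} (e₁ : A ≡ A′) (e : A ∨ B ≡ A′ ∨ B′) (P : Tm Γ (m A)) →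
          cast e (σ₁ P) ≡ σ₁ (cast e₁ P)
cast-σ₁ refl refl P = refl

cast-σ₂ : ∀ {Γ A B A′ B′} (e₂ : B ≡ B′) (e : A ∨ B ≡ A′ ∨ B′) (P : Tm Γ (m B)) →
          cast e (σ₂ P) ≡ σ₂ (cast e₂ P)
cast-σ₂ refl refl P = refl

cast-pair : ∀ {Γ A B A′ B′} (e₁ : A ≡ A′) (e₂ : B ≡ B′) (e : A ∧ B ≡ A′ ∧ B′)
            (P : Tm Γ (m A)) (Q : Tm Γ (m B)) →
            cast e (pair P Q) ≡ pair (cast e₁ P) (cast e₂ Q)
cast-pair refl refl refl P Q = refl

neg-injective : ∀ {A B} → neg A ≡ neg B → A ≡ B
neg-injective {A} {B} e = trans (sym (neg-invol A)) (trans (cong neg e) (neg-invol B))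

_≐_ : ∀ {Γ Δ} → Sub Γ Δ → Sub Γ Δ → Set
σ ≐ τ = ∀ {A} (x : _ ∋ A) → σ x ≡ τ x

rename-cong : ∀ {Γ Δ C} {ρ ρ′ : Ren Γ Δ} → (∀ {A} (x : Γ ∋ A) → ρ x ≡ ρ′ x) →
              (t : Tm Γ C) → rename ρ t ≡ rename ρ′ t
rename-cong h (var x)    = cong var (h x)
rename-cong h (pair P Q) = cong₂ pair (rename-cong h P) (rename-cong h Q)
rename-cong h (σ₁ P)     = cong σ₁ (rename-cong h P)
rename-cong h (σ₂ P)     = cong σ₂ (rename-cong h P)
rename-cong h (lam P)    = cong lam (rename-cong h′ P)
  where h′ : ∀ {A} x → ext _ {A} x ≡ ext _ x
        h′ here      = refl
        h′ (there x) = cong there (h x)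
rename-cong h (P ⋆ Q)    = cong₂ _⋆_ (rename-cong h P) (rename-cong h Q)

rename-rename : ∀ {Γ Δ Θ C} (ρ : Ren Γ Δ) (ρ′ : Ren Δ Θ) (t : Tm Γ C) →
                rename ρ′ (rename ρ t) ≡ rename (λ x → ρ′ (ρ x)) t
rename-rename ρ ρ′ (var x)    = refl
rename-rename ρ ρ′ (pair P Q) = cong₂ pair (rename-rename ρ ρ′ P) (rename-rename ρ ρ′ Q)
rename-rename ρ ρ′ (σ₁ P)     = cong σ₁ (rename-rename ρ ρ′ P)
rename-rename ρ ρ′ (σ₂ P)     = cong σ₂ (rename-rename ρ ρ′ P)
rename-rename ρ ρ′ (lam P)    =
  cong lam (trans (rename-rename (ext ρ) (ext ρ′) P) (rename-cong h P))
  where h : ∀ {A} x → ext ρ′ {A} (ext ρ x) ≡ ext (λ y → ρ′ (ρ y)) x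
        h here      = refl
        h (there x) = refl
rename-rename ρ ρ′ (P ⋆ Q)    = cong₂ _⋆_ (rename-rename ρ ρ′ P) (rename-rename ρ ρ′ Q)

subst-cong : ∀ {Γ Δ C} {σ τ : Sub Γ Δ} → σ ≐ τ → (t : Tm Γ C) → subst-tm σ t ≡ subst-tm τ t
subst-cong h (var x)    = h x
subst-cong h (pair P Q) = cong₂ pair (subst-cong h P) (subst-cong h Q)
subst-cong h (σ₁ P)     = cong σ₁ (subst-cong h P)
subst-cong h (σ₂ P)     = cong σ₂ (subst-cong h P)
subst-cong {σ = σ} {τ} h (lam P) = cong lam (subst-cong h′ P)
  where h′ : exts {B = _} σ ≐ exts τ
        h′ here      = refl
        h′ (there x) = cong weaken (h x)
subst-cong h (P ⋆ Q)    = cong₂ _⋆_ (subst-cong h P) (subst-cong h Q)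

subst-rename : ∀ {Γ Δ Θ C} (ρ : Ren Γ Δ) (σ : Sub Δ Θ) (t : Tm Γ C) →
               subst-tm σ (rename ρ t) ≡ subst-tm (λ x → σ (ρ x)) t
subst-rename ρ σ (var x)    = refl
subst-rename ρ σ (pair P Q) = cong₂ pair (subst-rename ρ σ P) (subst-rename ρ σ Q)
subst-rename ρ σ (σ₁ P)     = cong σ₁ (subst-rename ρ σ P)
subst-rename ρ σ (σ₂ P)     = cong σ₂ (subst-rename ρ σ P)
subst-rename ρ σ (lam P)    =
  cong lam (trans (subst-rename (ext ρ) (exts σ) P) (subst-cong h P))
  where h : (λ {A} x → exts {B = _} σ {A} (ext ρ x)) ≐ exts (λ y → σ (ρ y))
        h here      = refl
        h (there x) = refl
subst-rename ρ σ (P ⋆ Q)    = cong₂ _⋆_ (subst-rename ρ σ P) (subst-rename ρ σ Q)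

rename-subst : ∀ {Γ Δ Θ C} (σ : Sub Γ Δ) (ρ : Ren Δ Θ) (t : Tm Γ C) →
               rename ρ (subst-tm σ t) ≡ subst-tm (λ x → rename ρ (σ x)) t
rename-subst σ ρ (var x)    = refl
rename-subst σ ρ (pair P Q) = cong₂ pair (rename-subst σ ρ P) (rename-subst σ ρ Q)
rename-subst σ ρ (σ₁ P)     = cong σ₁ (rename-subst σ ρ P)
rename-subst σ ρ (σ₂ P)     = cong σ₂ (rename-subst σ ρ P)
rename-subst σ ρ (lam P)    =
  cong lam (trans (rename-subst (exts σ) (ext ρ) P) (subst-cong h P))
  where h : (λ {A} x → rename (ext {B = _} ρ) (exts σ {A} x)) ≐ exts (λ y → rename ρ (σ y))
        h here      = refl
        h (there x) = trans (rename-rename there (ext ρ) (σ x)) (sym (rename-rename ρ there (σ x)))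
rename-subst σ ρ (P ⋆ Q)    = cong₂ _⋆_ (rename-subst σ ρ P) (rename-subst σ ρ Q)

subst-subst : ∀ {Γ Δ Θ C} (σ : Sub Γ Δ) (τ : Sub Δ Θ) (t : Tm Γ C) →
              subst-tm τ (subst-tm σ t) ≡ subst-tm (λ x → subst-tm τ (σ x)) t
subst-subst σ τ (var x)    = refl
subst-subst σ τ (pair P Q) = cong₂ pair (subst-subst σ τ P) (subst-subst σ τ Q)
subst-subst σ τ (σ₁ P)     = cong σ₁ (subst-subst σ τ P)
subst-subst σ τ (σ₂ P)     = cong σ₂ (subst-subst σ τ P)
subst-subst σ τ (lam P)    =
  cong lam (trans (subst-subst (exts σ) (exts τ) P) (subst-cong h P))
  where h : (λ {A} x → subst-tm (exts {B = _} τ) (exts σ {A} x)) ≐ exts (λ y → subst-tm τ (σ y))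
        h here      = refl
        h (there x) = trans (subst-rename there (exts τ) (σ x)) (sym (rename-subst τ there (σ x)))
subst-subst σ τ (P ⋆ Q)    = cong₂ _⋆_ (subst-subst σ τ P) (subst-subst σ τ Q)

subst-id : ∀ {Γ C} (t : Tm Γ C) → subst-tm var t ≡ t
subst-id (var x)    = refl
subst-id (pair P Q) = cong₂ pair (subst-id P) (subst-id Q)
subst-id (σ₁ P)     = cong σ₁ (subst-id P)
subst-id (σ₂ P)     = cong σ₂ (subst-id P)
subst-id (lam P)    = cong lam (trans (subst-cong h P) (subst-id P))
  where h : exts {B = _} var ≐ var
        h here      = refl
        h (there x) = refl
subst-id (P ⋆ Q)    = cong₂ _⋆_ (subst-id P) (subst-id Q)

rename-as-subst : ∀ {Γ Δ C} (ρ : Ren Γ Δ) (t : Tm Γ C) → rename ρ t ≡ subst-tm (λ x → var (ρ x)) t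
rename-as-subst ρ (var x)    = refl
rename-as-subst ρ (pair P Q) = cong₂ pair (rename-as-subst ρ P) (rename-as-subst ρ Q)
rename-as-subst ρ (σ₁ P)     = cong σ₁ (rename-as-subst ρ P)
rename-as-subst ρ (σ₂ P)     = cong σ₂ (rename-as-subst ρ P)
rename-as-subst ρ (lam P)    = cong lam (trans (rename-as-subst (ext ρ) P) (subst-cong h P))
  where h : (λ {A} x → var (ext {B = _} ρ {A} x)) ≐ exts (λ y → var (ρ y))
        h here      = refl
        h (there x) = refl
rename-as-subst ρ (P ⋆ Q)    = cong₂ _⋆_ (rename-as-subst ρ P) (rename-as-subst ρ Q)

weaken-[] : ∀ {Γ A C} (X : Tm Γ C) (Q : Tm Γ (m A)) → weaken X [ Q ] ≡ X
weaken-[] X Q = trans (subst-rename there (single Q) X) (subst-id X)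

subst-weaken : ∀ {Γ Δ B C} (σ : Sub Γ Δ) (P : Tm Γ C) →
               subst-tm (exts {B = B} σ) (weaken P) ≡ weaken (subst-tm σ P)
subst-weaken σ P = trans (subst-rename there (exts σ) P) (sym (rename-subst σ there P))

subst-[] : ∀ {Γ Δ A C} (σ : Sub Γ Δ) (P : Tm (A ∷ Γ) C) (Q : Tm Γ (m A)) →
           subst-tm σ (P [ Q ]) ≡ subst-tm (exts σ) P [ subst-tm σ Q ]
subst-[] σ P Q =
  trans (subst-subst (single Q) σ P)
        (sym (trans (subst-subst (exts σ) (single (subst-tm σ Q)) P) (subst-cong h P)))
  where h : (λ {A′} x → subst-tm (single (subst-tm σ Q)) (exts σ {A′} x)) ≐ (λ x → subst-tm σ (single Q x))
        h here      = refl
        h (there x) = weaken-[] (σ x) (subst-tm σ Q)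

subst-cast : ∀ {Γ Δ A B} (σ : Sub Γ Δ) (e : A ≡ B) (t : Tm Γ (m A)) →
             subst-tm σ (cast e t) ≡ cast e (subst-tm σ t)
subst-cast σ refl t = refl

-- In η′ and η⊥′ the types of the redex and the reduct are
-- given by equations, so that matching on such a step never has to unify a
-- neg-expression with another type.
data Postponed : Rel where
  η′     : ∀ {Γ A B} {t u : Tm Γ (m B)} (e : neg A ≡ B) (P : Tm Γ (m (neg A))) →
           t ≡ cast e (lam {A = A} (weaken P ⋆ var here)) → u ≡ cast e P → Postponed t u
  η⊥′    : ∀ {Γ A B} {t u : Tm Γ (m B)} (e : neg (neg A) ≡ B) (e′ : A ≡ B) (P : Tm Γ (m A)) →
           t ≡ cast e (lam {A = neg A} (_⋆_ {A = A} (var here) (weaken P))) → u ≡ cast e′ P →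
           Postponed t u
  swap   : ∀ {Γ A} (P : Tm Γ (m (neg A))) (Q : Tm Γ (m A)) → Postponed (P ⋆ Q) (cast¬¬ A Q ⋆ P)
  unswap : ∀ {Γ A} (P : Tm Γ (m (neg A))) (Q : Tm Γ (m A)) → Postponed (cast¬¬ A Q ⋆ P) (P ⋆ Q)

infix 4 _⟶_ _⇝_

_⟶_ : Rel
_⟶_ = _→βπ_

_⇝_ : Rel
_⇝_ = Compat Postponed

open module Terms {Γ} {C} = Postponement {Tm Γ C} _⟶_ _⇝_

η-postponed : ∀ {Γ C} {t u : Tm Γ C} → η-root t u → Postponed t u
η-postponed (η P)          = η′ refl P refl refl
η-postponed (η⊥ {A = A} P) = η⊥′ refl (sym (neg-invol A)) P refl refl

Substitutive : Rel → Set
Substitutive R = ∀ {Γ Δ C} (σ : Sub Γ Δ) {t u : Tm Γ C} → R t u → R (subst-tm σ t) (subst-tm σ u)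

compat-subst : ∀ {R : Rel} → Substitutive R → Substitutive (Compat R)
compat-subst h σ (root r)  = root (h σ r)
compat-subst h σ (pairˡ s) = pairˡ (compat-subst h σ s)
compat-subst h σ (pairʳ s) = pairʳ (compat-subst h σ s)
compat-subst h σ (σ₁-c s)  = σ₁-c (compat-subst h σ s)
compat-subst h σ (σ₂-c s)  = σ₂-c (compat-subst h σ s)
compat-subst h σ (lam-c s) = lam-c (compat-subst h (exts σ) s)
compat-subst h σ (⋆ˡ s)    = ⋆ˡ (compat-subst h σ s)
compat-subst h σ (⋆ʳ s)    = ⋆ʳ (compat-subst h σ s)

compat-rename : ∀ {R : Rel} → Substitutive R →
                ∀ {Γ Δ C} (ρ : Ren Γ Δ) {t u : Tm Γ C} →
                Compat R t u → Compat R (rename ρ t) (rename ρ u)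
compat-rename {R} h ρ {t} {u} s =
  subst₂ (Compat R) (sym (rename-as-subst ρ t)) (sym (rename-as-subst ρ u))
         (compat-subst h (λ x → var (ρ x)) s)

βπ-substitutive : Substitutive βπ-root
βπ-substitutive σ (β P Q) = subst (βπ-root _) (sym (subst-[] σ P Q)) (β _ _)
βπ-substitutive σ (β⊥ {A = A} P Q) =
  subst₂ βπ-root (cong (_⋆ lam (subst-tm (exts σ) P)) (sym (subst-cast σ (sym (neg-invol A)) Q)))
                 (sym (subst-[] σ P Q)) (β⊥ _ _)
βπ-substitutive σ (π₁ P₁ P₂ Q)  = π₁ _ _ _
βπ-substitutive σ (π₂ P₁ P₂ Q)  = π₂ _ _ _
βπ-substitutive σ (π⊥₁ Q P₁ P₂) = π⊥₁ _ _ _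
βπ-substitutive σ (π⊥₂ Q P₁ P₂) = π⊥₂ _ _ _

postponed-substitutive : Substitutive Postponed
postponed-substitutive σ (η′ refl P refl refl) =
  η′ refl (subst-tm σ P) (cong (λ X → lam (X ⋆ var here)) (subst-weaken σ P)) refl
postponed-substitutive σ (η⊥′ refl e′ P refl refl) =
  η⊥′ refl e′ (subst-tm σ P) (cong (λ X → lam (var here ⋆ X)) (subst-weaken σ P)) (subst-cast σ e′ P)
postponed-substitutive σ (swap {A = A} P Q) =
  subst (Postponed (subst-tm σ P ⋆ subst-tm σ Q))
        (cong (_⋆ subst-tm σ P) (sym (subst-cast σ (sym (neg-invol A)) Q))) (swap _ _)
postponed-substitutive σ (unswap {A = A} P Q) =
  subst (λ X → Postponed X (subst-tm σ P ⋆ subst-tm σ Q))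
        (cong (_⋆ subst-tm σ P) (sym (subst-cast σ (sym (neg-invol A)) Q))) (unswap _ _)

map-⟶⁺⇝* : ∀ {Γ C Δ D} (f : Tm Γ C → Tm Δ D) →
            (∀ {x y} → x ⟶ y → f x ⟶ f y) → (∀ {x y} → x ⇝ y → f x ⇝ f y) →
            ∀ {t v} → t ⟶⁺⇝* v → f t ⟶⁺⇝* f v
map-⟶⁺⇝* f h⟶ h⇝ (w , p , q) = f w , map⁺ p , gmap f h⇝ q
  where map⁺ : ∀ {x y} → x ⟶⁺ y → f x ⟶⁺ f y
        map⁺ [ s ]⁺   = [ h⟶ s ]⁺
        map⁺ (s ∷ ss) = h⟶ s ∷ map⁺ ss

⟶-rename : ∀ {Γ Δ C} (ρ : Ren Γ Δ) {t u : Tm Γ C} → t ⟶ u → rename ρ t ⟶ rename ρ u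
⟶-rename = compat-rename βπ-substitutive

⇝-rename : ∀ {Γ Δ C} (ρ : Ren Γ Δ) {t u : Tm Γ C} → t ⇝ u → rename ρ t ⇝ rename ρ u
⇝-rename = compat-rename postponed-substitutive

subst-⇝* : ∀ {Γ Δ C} (σ τ : Sub Γ Δ) → (∀ {A} (x : Γ ∋ A) → σ x ⇝* τ x) →
           (t : Tm Γ C) → subst-tm σ t ⇝* subst-tm τ t
subst-⇝* σ τ h (var x)    = h x
subst-⇝* σ τ h (pair P Q) =
  gmap (λ X → pair X (subst-tm σ Q)) pairˡ (subst-⇝* σ τ h P) ++*
  gmap (pair (subst-tm τ P)) pairʳ (subst-⇝* σ τ h Q)
subst-⇝* σ τ h (σ₁ P)     = gmap σ₁ σ₁-c (subst-⇝* σ τ h P)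
subst-⇝* σ τ h (σ₂ P)     = gmap σ₂ σ₂-c (subst-⇝* σ τ h P)
subst-⇝* σ τ h (lam P)    = gmap lam lam-c (subst-⇝* (exts σ) (exts τ) h′ P)
  where h′ : ∀ {A} (x : _ ∋ A) → exts σ x ⇝* exts τ x
        h′ here      = ε
        h′ (there x) = gmap weaken (⇝-rename there) (h x)
subst-⇝* σ τ h (P ⋆ Q)    =
  gmap (_⋆ subst-tm σ Q) ⋆ˡ (subst-⇝* σ τ h P) ++*
  gmap (subst-tm τ P ⋆_) ⋆ʳ (subst-⇝* σ τ h Q)

[]-⇝*-argument : ∀ {Γ A C} (P : Tm (A ∷ Γ) C) {Q Q′ : Tm Γ (m A)} → Q ⇝ Q′ → P [ Q ] ⇝* P [ Q′ ]
[]-⇝*-argument P {Q} {Q′} s = subst-⇝* (single Q) (single Q′) h P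
  where h : ∀ {A} (x : _ ∋ A) → single Q x ⇝* single Q′ x
        h here      = step* s
        h (there x) = ε

[]-⇝-body : ∀ {Γ A C} {P P′ : Tm (A ∷ Γ) C} (Q : Tm Γ (m A)) → P ⇝ P′ → P [ Q ] ⇝ P′ [ Q ]
[]-⇝-body Q = compat-subst postponed-substitutive (single Q)

cast-step : ∀ {R : Rel} {Γ A B} (e : A ≡ B) {x y : Tm Γ (m A)} →
            Compat R x y → Compat R (cast e x) (cast e y)
cast-step refl s = s

cast-step-from : ∀ {R : Rel} {Γ A B} (e : A ≡ B) {x : Tm Γ (m A)} {y} → Compat R (cast e x) y →
                 ∃[ y′ ] (Compat R x y′ × y ≡ cast e y′)
cast-step-from refl s = _ , s , refl

cast-step-to : ∀ {R : Rel} {Γ A B} (e : A ≡ B) {x : Tm Γ (m A)} {y} → Compat R y (cast e x) →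
               ∃[ y′ ] (y ≡ cast e y′ × Compat R y′ x)
cast-step-to refl s = _ , refl , s

infix 4 _⟶⇝*_

_⟶⇝*_ : ∀ {Γ C} → Tm Γ C → Tm Γ C → Set
t ⟶⇝* v = ∃[ w ] (t ⟶ w × w ⇝* v)

-- a root βπ-redex P ⋆ Q is mirrored by a redex of the exchanged cut Q ⋆ P:
-- β and β^⊥ swap roles, as do π and π^⊥ (whose reducts are exchanged back)
mirror-redex : ∀ {Γ A} {P : Tm Γ (m (neg A))} {Q : Tm Γ (m A)} {v} →
               βπ-root (P ⋆ Q) v → cast¬¬ A Q ⋆ P ⟶⇝* v
mirror-redex (β P Q) = _ , root (β⊥ P Q) , ε
mirror-redex (β⊥ {A = A} P Q) = _ , subst (_⟶ P [ Q ]) (sym cut≡) (root (β P Q)) , ε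
  where
    cut≡ : cast¬¬ (neg A) (lam P) ⋆ cast¬¬ A Q ≡ lam P ⋆ Q
    cut≡ = trans (cut-cast (neg-invol A) (cast¬¬ (neg A) (lam P)) (cast¬¬ A Q))
                 (cong₂ _⋆_ (cast-cancel (sym (neg-invol (neg A))) (cong neg (neg-invol A)) (lam P))
                            (cast-cancel (sym (neg-invol A)) (neg-invol A) Q))
mirror-redex (π₁ {A = A} {B = B} P₁ P₂ Q) =
  _ , subst (λ X → X ⋆ pair P₁ P₂ ⟶ cast¬¬ A Q ⋆ P₁)
            (sym (cast-σ₁ (sym (neg-invol A)) (sym (neg-invol (A ∨ B))) Q)) (root (π⊥₁ _ P₁ P₂)) ,
  step* (root (unswap P₁ Q))
mirror-redex (π₂ {A = A} {B = B} P₁ P₂ Q) =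
  _ , subst (λ X → X ⋆ pair P₁ P₂ ⟶ cast¬¬ B Q ⋆ P₂)
            (sym (cast-σ₂ (sym (neg-invol B)) (sym (neg-invol (A ∨ B))) Q)) (root (π⊥₂ _ P₁ P₂)) ,
  step* (root (unswap P₂ Q))
mirror-redex (π⊥₁ {A = A} {B = B} Q P₁ P₂) =
  _ , subst (λ X → X ⋆ σ₁ Q ⟶ cast¬¬ A P₁ ⋆ Q)
            (sym (cast-pair (sym (neg-invol A)) (sym (neg-invol B)) (sym (neg-invol (A ∧ B))) P₁ P₂))
            (root (π₁ _ _ Q)) ,
  step* (root (unswap Q P₁))
mirror-redex (π⊥₂ {A = A} {B = B} Q P₁ P₂) =
  _ , subst (λ X → X ⋆ σ₂ Q ⟶ cast¬¬ B P₂ ⋆ Q)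
            (sym (cast-pair (sym (neg-invol A)) (sym (neg-invol B)) (sym (neg-invol (A ∧ B))) P₁ P₂))
            (root (π₂ _ _ Q)) ,
  step* (root (unswap Q P₂))

postpone-unswap : ∀ {Γ A} (P : Tm Γ (m (neg A))) (Q : Tm Γ (m A)) {v} →
                  P ⋆ Q ⟶ v → cast¬¬ A Q ⋆ P ⟶⇝* v
postpone-unswap P Q (⋆ˡ s) = _ , ⋆ʳ s , step* (root (unswap _ Q))
postpone-unswap {A = A} P Q (⋆ʳ s) = _ , ⋆ˡ (cast-step (sym (neg-invol A)) s) , step* (root (unswap P _))
postpone-unswap P Q (root r) = mirror-redex r

postpone-swap : ∀ {Γ A} (P : Tm Γ (m (neg A))) (Q : Tm Γ (m A)) {v} →
                cast¬¬ A Q ⋆ P ⟶ v → P ⋆ Q ⟶⇝* v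
postpone-swap {A = A} P Q (⋆ˡ s) with cast-step-from (sym (neg-invol A)) s
... | Q′ , s′ , refl = _ , ⋆ʳ s′ , step* (root (swap P Q′))
postpone-swap P Q (⋆ʳ s) = _ , ⋆ˡ s , step* (root (swap _ Q))
postpone-swap {A = A} P Q (root r) =
  let (w , s , rest) = mirror-redex {P = cast¬¬ A Q} {Q = P} r
  in w , subst (_⟶ w) (sym cut≡) s , rest
  where
    cut≡ : P ⋆ Q ≡ cast¬¬ (neg A) P ⋆ cast¬¬ A Q
    cut≡ = trans (cut-cast (sym (neg-invol A)) P Q) (cong (_⋆ cast¬¬ A Q) (cast-irrelevant _ _ P))

-- an η-redex λx(P ⋆ x) on the left of a cut with R: β contracts the cut to
-- the η-reduct P ⋆ R, which then performs the given root step
η-redex-left : ∀ {Γ A′ A} (e₀ : A′ ≡ A) (e : neg A′ ≡ neg A) (P : Tm Γ (m (neg A′)))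
               {t u : Tm Γ (m (neg A))} {R : Tm Γ (m A)} {v} →
               t ≡ cast e (lam (weaken P ⋆ var here)) → u ≡ cast e P → βπ-root (u ⋆ R) v →
               t ⋆ R ⟶⁺⇝* v
η-redex-left refl refl P {R = R} refl refl r = _ , contract ∷ [ root r ]⁺ , ε
  where
    contract : lam (weaken P ⋆ var here) ⋆ R ⟶ P ⋆ R
    contract = subst (λ X → lam (weaken P ⋆ var here) ⋆ R ⟶ X ⋆ R) (weaken-[] P R) (root (β _ R))

-- an η^⊥-redex λx(x ⋆ P) on the left of a cut with R: β contracts the cut to
-- R ⋆ P, the exchange of the η-reduct P ⋆ R
η⊥-redex-left : ∀ {Γ A′ A} (e₀ : neg A′ ≡ A) (e : neg (neg A′) ≡ neg A) (e′ : A′ ≡ neg A)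
                (P : Tm Γ (m A′)) {t u : Tm Γ (m (neg A))} {R : Tm Γ (m A)} {v} →
                t ≡ cast e (lam {A = neg A′} (var here ⋆ weaken P)) → u ≡ cast e′ P →
                βπ-root (u ⋆ R) v → t ⋆ R ⟶⁺⇝* v
η⊥-redex-left {A′ = A′} refl refl e′ P {R = R} refl refl r =
  let (w , s , rest) = postpone-swap R P (root (subst (λ X → βπ-root (X ⋆ R) _) P≡ r))
  in w , contract ∷ [ s ]⁺ , rest
  where
    P≡ : cast e′ P ≡ cast¬¬ A′ P
    P≡ = cast-irrelevant e′ (sym (neg-invol A′)) P
    contract : lam (var here ⋆ weaken P) ⋆ R ⟶ R ⋆ P
    contract = subst (λ X → lam (var here ⋆ weaken P) ⋆ R ⟶ R ⋆ X) (weaken-[] P R) (root (β _ R))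

postpone-root-left : ∀ {Γ A} {t u : Tm Γ (m (neg A))} {R : Tm Γ (m A)} {v} →
                     Postponed t u → βπ-root (u ⋆ R) v → t ⋆ R ⟶⁺⇝* v
postpone-root-left (η′ e P t≡ u≡) r     = η-redex-left (neg-injective e) e P t≡ u≡ r
postpone-root-left (η⊥′ e e′ P t≡ u≡) r = η⊥-redex-left (neg-injective e) e e′ P t≡ u≡ r

-- a postponed root step in the right side of a cut, followed by a root step;
-- here β^⊥ contracts the cut and one or two exchanges recover the η-reduct
postpone-root-right : ∀ {Γ A} {L : Tm Γ (m (neg A))} {t u : Tm Γ (m A)} {v} →
                      Postponed t u → βπ-root (L ⋆ u) v → L ⋆ t ⟶⁺⇝* v
postpone-root-right {L = L} (η′ {A = A} refl P refl refl) r =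
  let (w , s , rest) = postpone-swap P L′ (root (subst (λ X → βπ-root (X ⋆ P) _) L≡ r))
  in w , contract ∷ [ s ]⁺ , rest
  where
    L′ = cast (neg-invol A) L
    L≡ : L ≡ cast¬¬ A L′
    L≡ = sym (cast-cancel (neg-invol A) (sym (neg-invol A)) L)
    contract : L ⋆ lam (weaken P ⋆ var here) ⟶ P ⋆ L′
    contract = subst₂ _⟶_ (cong (_⋆ lam (weaken P ⋆ var here)) (sym L≡)) (cong (_⋆ L′) (weaken-[] P L′))
                          (root (β⊥ _ L′))
postpone-root-right {L = L} (η⊥′ {A = A} refl e′ P refl refl) r =
  let (w₁ , s₁ , rest₁) = postpone-swap (cast¬¬ A P) L′ (root r′)
      (w₂ , s₂ , rest₂) = postpone-swap L′ P s₁
  in w₂ , contract ∷ [ s₂ ]⁺ , rest₂ ++* rest₁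
  where
    L′ = cast (neg-invol (neg A)) L
    L≡ : L ≡ cast¬¬ (neg A) L′
    L≡ = sym (cast-cancel (neg-invol (neg A)) (sym (neg-invol (neg A))) L)
    r′ : βπ-root (cast¬¬ (neg A) L′ ⋆ cast¬¬ A P) _
    r′ = subst₂ (λ X Y → βπ-root (X ⋆ Y) _) L≡ (cast-irrelevant e′ (sym (neg-invol A)) P) r
    contract : L ⋆ lam (var here ⋆ weaken P) ⟶ L′ ⋆ P
    contract = subst₂ _⟶_ (cong (_⋆ lam (var here ⋆ weaken P)) (sym L≡)) (cong (L′ ⋆_) (weaken-[] P L′))
                          (root (β⊥ _ L′))

postpone-cut-left : ∀ {Γ A} {t u : Tm Γ (m (neg A))} {R : Tm Γ (m A)} {v} →
                    βπ-root (u ⋆ R) v → t ⇝ u → t ⋆ R ⟶⁺⇝* v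
postpone-cut-left (β P Q)  (lam-c s)       = _ , [ root (β _ Q) ]⁺ , step* ([]-⇝-body Q s)
postpone-cut-left (β⊥ {A = A} P Q) s with cast-step-to (sym (neg-invol A)) s
... | Q′ , refl , s′                        = _ , [ root (β⊥ P Q′) ]⁺ , []-⇝*-argument P s′
postpone-cut-left (π₁ P₁ P₂ Q)  (pairˡ s)   = _ , [ root (π₁ _ P₂ Q) ]⁺ , step* (⋆ˡ s)
postpone-cut-left (π₁ P₁ P₂ Q)  (pairʳ s)   = _ , [ root (π₁ P₁ _ Q) ]⁺ , ε
postpone-cut-left (π₂ P₁ P₂ Q)  (pairˡ s)   = _ , [ root (π₂ _ P₂ Q) ]⁺ , ε
postpone-cut-left (π₂ P₁ P₂ Q)  (pairʳ s)   = _ , [ root (π₂ P₁ _ Q) ]⁺ , step* (⋆ˡ s)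
postpone-cut-left (π⊥₁ Q P₁ P₂) (σ₁-c s)    = _ , [ root (π⊥₁ _ P₁ P₂) ]⁺ , step* (⋆ˡ s)
postpone-cut-left (π⊥₂ Q P₁ P₂) (σ₂-c s)    = _ , [ root (π⊥₂ _ P₁ P₂) ]⁺ , step* (⋆ˡ s)
postpone-cut-left r             (root s)    = postpone-root-left s r

postpone-cut-right : ∀ {Γ A} {L : Tm Γ (m (neg A))} {t u : Tm Γ (m A)} {v} →
                     βπ-root (L ⋆ u) v → t ⇝ u → L ⋆ t ⟶⁺⇝* v
postpone-cut-right (β P Q)       s          = _ , [ root (β P _) ]⁺ , []-⇝*-argument P s
postpone-cut-right (β⊥ P Q)      (lam-c s)  = _ , [ root (β⊥ _ Q) ]⁺ , step* ([]-⇝-body Q s)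
postpone-cut-right (π₁ P₁ P₂ Q)  (σ₁-c s)   = _ , [ root (π₁ P₁ P₂ _) ]⁺ , step* (⋆ʳ s)
postpone-cut-right (π₂ P₁ P₂ Q)  (σ₂-c s)   = _ , [ root (π₂ P₁ P₂ _) ]⁺ , step* (⋆ʳ s)
postpone-cut-right (π⊥₁ Q P₁ P₂) (pairˡ s)  = _ , [ root (π⊥₁ Q _ P₂) ]⁺ , step* (⋆ʳ s)
postpone-cut-right (π⊥₁ Q P₁ P₂) (pairʳ s)  = _ , [ root (π⊥₁ Q P₁ _) ]⁺ , ε
postpone-cut-right (π⊥₂ Q P₁ P₂) (pairˡ s)  = _ , [ root (π⊥₂ Q _ P₂) ]⁺ , ε
postpone-cut-right (π⊥₂ Q P₁ P₂) (pairʳ s)  = _ , [ root (π⊥₂ Q P₁ _) ]⁺ , step* (⋆ʳ s)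
postpone-cut-right r             (root s)   = postpone-root-right s r

postpone : ∀ {Γ C} {t u v : Tm Γ C} → t ⇝ u → u ⟶ v → t ⟶⁺⇝* v
postpone (root (η′ refl P refl refl)) s =
  _ , [ lam-c (⋆ˡ (⟶-rename there s)) ]⁺ , step* (root (η′ refl _ refl refl))
postpone (root (η⊥′ refl e′ P refl refl)) s with cast-step-from e′ s
... | P′ , s′ , refl = _ , [ lam-c (⋆ʳ (⟶-rename there s′)) ]⁺ , step* (root (η⊥′ refl e′ P′ refl refl))
postpone (root (swap P Q)) s   = let (w , s′ , rest) = postpone-swap P Q s in w , [ s′ ]⁺ , rest
postpone (root (unswap P Q)) s = let (w , s′ , rest) = postpone-unswap P Q s in w , [ s′ ]⁺ , rest
postpone (pairˡ p) (pairˡ s) = map-⟶⁺⇝* (λ X → pair X _) pairˡ pairˡ (postpone p s)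
postpone (pairˡ p) (pairʳ s) = _ , [ pairʳ s ]⁺ , step* (pairˡ p)
postpone (pairʳ p) (pairˡ s) = _ , [ pairˡ s ]⁺ , step* (pairʳ p)
postpone (pairʳ p) (pairʳ s) = map-⟶⁺⇝* (pair _) pairʳ pairʳ (postpone p s)
postpone (σ₁-c p)  (σ₁-c s)  = map-⟶⁺⇝* σ₁ σ₁-c σ₁-c (postpone p s)
postpone (σ₂-c p)  (σ₂-c s)  = map-⟶⁺⇝* σ₂ σ₂-c σ₂-c (postpone p s)
postpone (lam-c p) (lam-c s) = map-⟶⁺⇝* lam lam-c lam-c (postpone p s)
postpone (⋆ˡ p)    (⋆ˡ s)    = map-⟶⁺⇝* (_⋆ _) ⋆ˡ ⋆ˡ (postpone p s)
postpone (⋆ˡ p)    (⋆ʳ s)    = _ , [ ⋆ʳ s ]⁺ , step* (⋆ˡ p)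
postpone (⋆ˡ p)    (root r)  = postpone-cut-left r p
postpone (⋆ʳ p)    (⋆ˡ s)    = _ , [ ⋆ˡ s ]⁺ , step* (⋆ʳ p)
postpone (⋆ʳ p)    (⋆ʳ s)    = map-⟶⁺⇝* (_ ⋆_) ⋆ʳ ⋆ʳ (postpone p s)
postpone (⋆ʳ p)    (root r)  = postpone-cut-right r p

size : ∀ {Γ C} → Tm Γ C → ℕ
size (var x)    = 1
size (pair P Q) = suc (size P + size Q)
size (σ₁ P)     = suc (size P)
size (σ₂ P)     = suc (size P)
size (lam P)    = suc (size P)
size (P ⋆ Q)    = suc (size P + size Q)

size-rename : ∀ {Γ Δ C} (ρ : Ren Γ Δ) (t : Tm Γ C) → size (rename ρ t) ≡ size t
size-rename ρ (var x)    = refl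
size-rename ρ (pair P Q) = cong₂ (λ a b → suc (a + b)) (size-rename ρ P) (size-rename ρ Q)
size-rename ρ (σ₁ P)     = cong suc (size-rename ρ P)
size-rename ρ (σ₂ P)     = cong suc (size-rename ρ P)
size-rename ρ (lam P)    = cong suc (size-rename (ext ρ) P)
size-rename ρ (P ⋆ Q)    = cong₂ (λ a b → suc (a + b)) (size-rename ρ P) (size-rename ρ Q)

size-cast : ∀ {Γ A B} (e : A ≡ B) (t : Tm Γ (m A)) → size (cast e t) ≡ size t
size-cast refl t = refl

η-decreases-size : ∀ {Γ C} {t u : Tm Γ C} → Compat η-root t u → size u < size t
η-decreases-size (root (η P)) =
  subst (λ n → size P < suc (suc (n + 1))) (sym (size-rename there P))
        (s≤s (m≤n⇒m≤1+n (m≤m+n (size P) 1)))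
η-decreases-size (root (η⊥ {A = A} P)) =
  subst₂ (λ a b → a < suc (suc (suc b))) (sym (size-cast (sym (neg-invol A)) P)) (sym (size-rename there P))
         (m≤n⇒m≤1+n (m≤n⇒m≤1+n (n<1+n (size P))))
η-decreases-size (pairˡ {Q = Q} s) = s≤s (+-monoˡ-< (size Q) (η-decreases-size s))
η-decreases-size (pairʳ {P = P} s) = s≤s (+-monoʳ-< (size P) (η-decreases-size s))
η-decreases-size (σ₁-c s)          = s≤s (η-decreases-size s)
η-decreases-size (σ₂-c s)          = s≤s (η-decreases-size s)
η-decreases-size (lam-c s)         = s≤s (η-decreases-size s)
η-decreases-size (⋆ˡ {Q = Q} s)    = s≤s (+-monoˡ-< (size Q) (η-decreases-size s))
η-decreases-size (⋆ʳ {P = P} s)    = s≤s (+-monoʳ-< (size P) (η-decreases-size s))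

compat-mono : ∀ {R S : Rel} → (∀ {Γ C} {t u : Tm Γ C} → R t u → S t u) →
              ∀ {Γ C} {t u : Tm Γ C} → Compat R t u → Compat S t u
compat-mono f (root r)  = root (f r)
compat-mono f (pairˡ s) = pairˡ (compat-mono f s)
compat-mono f (pairʳ s) = pairʳ (compat-mono f s)
compat-mono f (σ₁-c s)  = σ₁-c (compat-mono f s)
compat-mono f (σ₂-c s)  = σ₂-c (compat-mono f s)
compat-mono f (lam-c s) = lam-c (compat-mono f s)
compat-mono f (⋆ˡ s)    = ⋆ˡ (compat-mono f s)
compat-mono f (⋆ʳ s)    = ⋆ʳ (compat-mono f s)

compat-⊎ : ∀ {R S : Rel} {Γ C} {t u : Tm Γ C} →
           Compat (λ x y → R x y ⊎ S x y) t u → Compat R t u ⊎ Compat S t u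
compat-⊎ (root r)  = Sum.map root root r
compat-⊎ (pairˡ s) = Sum.map pairˡ pairˡ (compat-⊎ s)
compat-⊎ (pairʳ s) = Sum.map pairʳ pairʳ (compat-⊎ s)
compat-⊎ (σ₁-c s)  = Sum.map σ₁-c σ₁-c (compat-⊎ s)
compat-⊎ (σ₂-c s)  = Sum.map σ₂-c σ₂-c (compat-⊎ s)
compat-⊎ (lam-c s) = Sum.map lam-c lam-c (compat-⊎ s)
compat-⊎ (⋆ˡ s)    = Sum.map ⋆ˡ ⋆ˡ (compat-⊎ s)
compat-⊎ (⋆ʳ s)    = Sum.map ⋆ʳ ⋆ʳ (compat-⊎ s)

βπη-split : ∀ {Γ C} {t u : Tm Γ C} → t →βπη u → t ⟶ u ⊎ (t ⇝ u × size u < size t)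
βπη-split s = Sum.map₂ (λ h → compat-mono η-postponed h , η-decreases-size h) (compat-⊎ s)

corollary1p18 : (∀ {Γ C} (t : Tm Γ C) → SN _→βπ_ t) →
    ∀ {Γ C} (t : Tm Γ C) → SN _→βπη_ t
corollary1p18 sn-βπ t = sn-by-postponement postpone _→βπη_ size βπη-split (sn-βπ t)
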